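{- Let $N,a,b,\ell,q\in\mathbb{N}$ with $b\le a$ and $\delta\in[0,1]$ with $\delta>1-\frac{1}{ab}$. Let $C\subseteq[q]^\ell$ be a $(\log_q N,\ell,\delta)_q$ code, and label $N$ of its codewords as $C(1),\ldots,C(N)$. Then the family $\mathcal{H}=\{h_i:[N]\to[q]\mid i\in[\ell]\}$ defined by $h_i(x)=C(x)_i$ (the $i$-th coordinate of $C(x)$) is an $(N,a,b,\ell)_q$-Hit and Miss hash family.
   Context: For $x,y\in\Sigma^\ell$, $\Delta(x,y)=\frac{1}{\ell}|\{i\in[\ell]: x_i\neq y_i\}|$. A $(k,\ell,\delta)_q$ code is a set $C\subseteq\Sigma^\ell$ with $|\Sigma|=q$, $|C|\ge q^k$, and $\Delta(x,y)\ge\delta$ for all distinct $x,y\in C$. A family $\{h_i:[N]\to[q]\mid i\in[\ell]\}$ is an $(N,a,b,\ell)_q$-Hit and Miss hash family if for every pair of disjoint $A,B\subseteq[N]$ with $|A|\le a$, $|B|\le b$ there exists $i\in[\ell]$ with $h_i(x)\neq h_i(y)$ for all $(x,y)\in A\times B$.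
   Formalization: The parameter δ ranges over the rationals in [0,1] instead of the reals. -}

module Defs where

open import Data.Nat using (ℕ; zero; suc; _+_; _≤_; NonZero)
open import Data.Fin using (Fin)
open import Data.Fin.Properties using (_≟_)
open import Data.Fin.Subset using (Subset; _∈_; _∉_; ∣_∣)
open import Data.Vec using (Vec; []; _∷_)
open import Data.Integer using (+_)
open import Data.Rational using (ℚ; _/_) renaming (_≤_ to _≤ℚ_)
open import Data.Product using (Σ; ∃; _×_)
open import Function.Bundles using (_↣_)
open import Relation.Nullary using (¬_; yes; no)
open import Relation.Binary.PropositionalEquality using (_≡_; _≢_)

Word : ℕ → ℕ → Set
Word q ℓ = Vec (Fin q) ℓ

diffCount : ∀ {q ℓ} → Word q ℓ → Word q ℓ → ℕ
diffCount [] [] = 0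
diffCount (x ∷ xs) (y ∷ ys) with x ≟ y
... | yes _ = diffCount xs ys
... | no  _ = suc (diffCount xs ys)

Δ : ∀ {q ℓ} .{{_ : NonZero ℓ}} → Word q ℓ → Word q ℓ → ℚ
Δ {ℓ = ℓ} x y = (+ diffCount x y) / ℓ

-- C ⊆ Σ^ℓ (given as a predicate) is a (log_q N, ℓ, δ)_q code:
-- |C| ≥ q^(log_q N) = N (witnessed by an injection Fin N ↣ C), and
-- Δ(x,y) ≥ δ for all distinct x,y ∈ C.
IsCode : (N q ℓ : ℕ) .{{_ : NonZero ℓ}} → ℚ → (Word q ℓ → Set) → Set
IsCode N q ℓ δ C =
  (Fin N ↣ Σ (Word q ℓ) C) ×
  (∀ x y → C x → C y → x ≢ y → δ ≤ℚ Δ x y)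

HitAndMiss : (N a b ℓ q : ℕ) → (Fin ℓ → Fin N → Fin q) → Set
HitAndMiss N a b ℓ q h =
  (A B : Subset N) →
  (∀ x → x ∈ A → x ∉ B) →
  ∣ A ∣ ≤ a → ∣ B ∣ ≤ b →
  ∃ λ (i : Fin ℓ) → ∀ x y → x ∈ A → y ∈ B → h i x ≢ h i y

module Submission where

-- For words u, v of length ℓ let agreement u v ∈ {0,1}^ℓ be the indicator
-- vector of the coordinates where u and v coincide; its total is ℓ - diffCount u v.
-- Fix disjoint A, B ⊆ [N] with |A| ≤ a, |B| ≤ b and put m = ab.  For x ∈ A, y ∈ B the
-- codewords lab x, lab y are distinct, so Δ ≥ δ > 1 - 1/m, which over ℕ says that
-- m · (number of agreements) < ℓ.  Summing the agreement vectors over all pairs of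
-- A × B yields a vector T with m · ΣT ≤ |A||B|(ℓ-1) ≤ m(ℓ-1), hence ΣT < ℓ, so some
-- coordinate i has T_i = 0: no pair of A × B agrees at i, i.e. h_i separates A from B.

open import Defs
open import Data.Nat using (ℕ; zero; suc; _+_; _*_; _∸_; _≤_; _<_; z≤n; s≤s; NonZero)
import Data.Nat.Properties as ℕₚ
open import Data.Nat.Properties using (m*n≢0)
open import Data.Bool using (true; false)
open import Data.Fin using (Fin; zero; suc)
open import Data.Fin.Properties using (_≟_)
open import Data.Fin.Subset using (Subset; _∈_; ∣_∣)
open import Data.Vec using (Vec; []; _∷_; lookup; zipWith; replicate; sum; here; there)
open import Data.Vec.Properties using (lookup-zipWith)
open import Data.Integer using (+_)
import Data.Integer.Properties as ℤₚ
open import Data.Rational using (ℚ; _/_; 0ℚ; 1ℚ; _-_; toℚᵘ)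
  renaming (_≤_ to _≤ℚ_; _<_ to _<ℚ_)
import Data.Rational.Properties as ℚₚ
open import Data.Rational.Unnormalised using (mkℚᵘ; _≃_; *≡*; *<*)
import Data.Rational.Unnormalised as ℚᵘ
import Data.Rational.Unnormalised.Properties as ℚᵘₚ
open import Data.Product using (∃; _,_)
open import Data.Empty using (⊥-elim-irr)
open import Function using (_∘_)
open import Function.Definitions using (Injective)
open import Relation.Nullary using (yes; no)
open import Relation.Binary.PropositionalEquality
  using (_≡_; _≢_; refl; sym; trans; cong; subst; module ≡-Reasoning)
open import Algebra.Properties.CommutativeSemigroup ℕₚ.+-commutativeSemigroup
  using (interchange)

-- The distance hypothesis over ℕ.  In unnormalised rationals mkℚᵘ p k stands for
-- p / (k + 1); first, 1 - 1/(k+1) = k/(k+1).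
one-minus-reciprocal : ∀ k → toℚᵘ (1ℚ - + 1 / suc k) ≃ mkℚᵘ (+ k) k
one-minus-reciprocal k =
  ℚᵘₚ.≃-trans (ℚₚ.toℚᵘ-homo-+ 1ℚ (Data.Rational.- (+ 1 / suc k)))
    (ℚᵘₚ.≃-trans (ℚᵘₚ.+-cong {ℚᵘ.1ℚᵘ} ℚᵘₚ.≃-refl minus-reciprocal) (*≡* cross-multiplied))
  where
  minus-reciprocal : toℚᵘ (Data.Rational.- (+ 1 / suc k)) ≃ ℚᵘ.- mkℚᵘ (+ 1) k
  minus-reciprocal = ℚᵘₚ.≃-trans (ℚₚ.toℚᵘ-homo‿- (+ 1 / suc k))
                       (ℚᵘₚ.-‿cong (ℚₚ.toℚᵘ-fromℚᵘ (mkℚᵘ (+ 1) k)))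
  cross-multiplied : ℚᵘ.↥ (ℚᵘ.1ℚᵘ ℚᵘ.- mkℚᵘ (+ 1) k) Data.Integer.* + suc k
                   ≡ + k Data.Integer.* ℚᵘ.↧ (ℚᵘ.1ℚᵘ ℚᵘ.- mkℚᵘ (+ 1) k)
  cross-multiplied rewrite ℕₚ.+-identityʳ k = refl

-- Clearing denominators in (m-1)/m < d/L gives m (L - d) < L, where m = k + 1.
few-non-matches : ∀ k L d → d ≤ L → k * L < d * suc k → suc k * (L ∸ d) < L
few-non-matches k L d d≤L k*L<d*m = ℕₚ.+-cancelʳ-< _ _ _ (begin-strict
    suc k * (L ∸ d) + d * suc k  ≡⟨ cong (_+_ (suc k * (L ∸ d))) (ℕₚ.*-comm d (suc k)) ⟩
    suc k * (L ∸ d) + suc k * d  ≡⟨ sym (ℕₚ.*-distribˡ-+ (suc k) (L ∸ d) d) ⟩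
    suc k * (L ∸ d + d)          ≡⟨ cong (suc k *_) (ℕₚ.m∸n+n≡m d≤L) ⟩
    L + k * L                    <⟨ ℕₚ.+-monoʳ-< L k*L<d*m ⟩
    L + d * suc k                ∎)
  where open ℕₚ.≤-Reasoning

large-fraction⇒small-complement : ∀ k l d → d ≤ suc l →
  1ℚ - + 1 / suc k <ℚ + d / suc l → suc k * (suc l ∸ d) < suc l
large-fraction⇒small-complement k l d d≤ gap
  with ℚᵘₚ.<-respʳ-≃ (ℚₚ.toℚᵘ-fromℚᵘ (mkℚᵘ (+ d) l))
         (ℚᵘₚ.<-respˡ-≃ (one-minus-reciprocal k) (ℚₚ.toℚᵘ-mono-< gap))
... | *<* cross = few-non-matches k (suc l) d d≤ (ℤₚ.+◃-cancel-< cross)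

agreement : ∀ {q n} → Word q n → Word q n → Vec ℕ n
agreement [] [] = []
agreement (x ∷ xs) (y ∷ ys) with x ≟ y
... | yes _ = 1 ∷ agreement xs ys
... | no  _ = 0 ∷ agreement xs ys

agreement+diffCount : ∀ {q n} (u v : Word q n) → sum (agreement u v) + diffCount u v ≡ n
agreement+diffCount [] [] = refl
agreement+diffCount (x ∷ xs) (y ∷ ys) with x ≟ y
... | yes _ = cong suc (agreement+diffCount xs ys)
... | no  _ = trans (ℕₚ.+-suc (sum (agreement xs ys)) (diffCount xs ys))
                    (cong suc (agreement+diffCount xs ys))

agreement-zero⇒differ : ∀ {q n} (u v : Word q n) i →
  lookup (agreement u v) i ≡ 0 → lookup u i ≢ lookup v i
agreement-zero⇒differ (x ∷ xs) (y ∷ ys) i zero-at-i with x ≟ y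
agreement-zero⇒differ (x ∷ xs) (y ∷ ys) zero    ()        | yes _
agreement-zero⇒differ (x ∷ xs) (y ∷ ys) (suc i) zero-at-i | yes _ =
  agreement-zero⇒differ xs ys i zero-at-i
agreement-zero⇒differ (x ∷ xs) (y ∷ ys) zero    _         | no x≢y = x≢y
agreement-zero⇒differ (x ∷ xs) (y ∷ ys) (suc i) zero-at-i | no _ =
  agreement-zero⇒differ xs ys i zero-at-i

far-words-agree-rarely : ∀ {q l} k (u v : Word q (suc l)) →
  1ℚ - + 1 / suc k <ℚ Δ u v → suc k * sum (agreement u v) < suc l
far-words-agree-rarely {l = l} k u v far =
  subst (λ t → suc k * t < suc l) complement
    (large-fraction⇒small-complement k l d d≤ far)
  where
  d = diffCount u v
  partition = agreement+diffCount u v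
  d≤ : d ≤ suc l
  d≤ = subst (d ≤_) partition (ℕₚ.m≤n+m d _)
  complement : suc l ∸ d ≡ sum (agreement u v)
  complement = trans (cong (_∸ d) (sym partition)) (ℕₚ.m+n∸n≡m _ d)

_+ᵥ_ : ∀ {n} → Vec ℕ n → Vec ℕ n → Vec ℕ n
_+ᵥ_ = zipWith _+_

sum-+ᵥ : ∀ {n} (u v : Vec ℕ n) → sum (u +ᵥ v) ≡ sum u + sum v
sum-+ᵥ [] [] = refl
sum-+ᵥ (x ∷ u) (y ∷ v) = begin
  x + y + sum (u +ᵥ v)      ≡⟨ cong (_+_ (x + y)) (sum-+ᵥ u v) ⟩
  x + y + (sum u + sum v)   ≡⟨ interchange x y (sum u) (sum v) ⟩
  x + sum u + (y + sum v)   ∎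
  where open ≡-Reasoning

sum-zeros : ∀ n → sum (replicate n 0) ≡ 0
sum-zeros zero    = refl
sum-zeros (suc n) = sum-zeros n

subsetSum : ∀ {N n} → (Fin N → Vec ℕ n) → Subset N → Vec ℕ n
subsetSum {n = n} F []    = replicate n 0
subsetSum F (true  ∷ A) = F zero +ᵥ subsetSum (F ∘ suc) A
subsetSum F (false ∷ A) = subsetSum (F ∘ suc) A

subsetSum-total : ∀ {N n} m c (F : Fin N → Vec ℕ n) (A : Subset N) →
  (∀ x → x ∈ A → m * sum (F x) ≤ c) → m * sum (subsetSum F A) ≤ ∣ A ∣ * c
subsetSum-total {n = n} m c F [] _
  rewrite sum-zeros n | ℕₚ.*-zeroʳ m = z≤n
subsetSum-total m c F (true ∷ A) bound
  rewrite sum-+ᵥ (F zero) (subsetSum (F ∘ suc) A)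
        | ℕₚ.*-distribˡ-+ m (sum (F zero)) (sum (subsetSum (F ∘ suc) A)) =
  ℕₚ.+-mono-≤ (bound zero here)
              (subsetSum-total m c (F ∘ suc) A (λ x x∈A → bound (suc x) (there x∈A)))
subsetSum-total m c F (false ∷ A) bound =
  subsetSum-total m c (F ∘ suc) A (λ x x∈A → bound (suc x) (there x∈A))

subsetSum-zero : ∀ {N n} (F : Fin N → Vec ℕ n) (A : Subset N) {i x} →
  lookup (subsetSum F A) i ≡ 0 → x ∈ A → lookup (F x) i ≡ 0
subsetSum-zero F (true ∷ A) {i} sum-zero here
  rewrite lookup-zipWith _+_ i (F zero) (subsetSum (F ∘ suc) A) =
  ℕₚ.m+n≡0⇒m≡0 _ sum-zero
subsetSum-zero F (true ∷ A) {i} sum-zero (there x∈A)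
  rewrite lookup-zipWith _+_ i (F zero) (subsetSum (F ∘ suc) A) =
  subsetSum-zero (F ∘ suc) A (ℕₚ.m+n≡0⇒n≡0 (lookup (F zero) i) sum-zero) x∈A
subsetSum-zero F (false ∷ A) sum-zero (there x∈A) =
  subsetSum-zero (F ∘ suc) A sum-zero x∈A

small-total⇒zero-entry : ∀ {n} (w : Vec ℕ n) → sum w < n → ∃ λ i → lookup w i ≡ 0
small-total⇒zero-entry (zero  ∷ w) _ = zero , refl
small-total⇒zero-entry (suc x ∷ w) (s≤s total<n)
  with small-total⇒zero-entry w (ℕₚ.≤-trans (s≤s (ℕₚ.m≤n+m (sum w) x)) total<n)
... | i , w[i]≡0 = suc i , w[i]≡0

separating-coordinate : ∀ {N q l} m .{{_ : NonZero m}} (w : Fin N → Word q (suc l))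
  (A B : Subset N) → ∣ A ∣ * ∣ B ∣ ≤ m →
  (∀ x y → x ∈ A → y ∈ B → m * sum (agreement (w x) (w y)) ≤ l) →
  ∃ λ i → ∀ x y → x ∈ A → y ∈ B → lookup (w x) i ≢ lookup (w y) i
separating-coordinate {l = l} m w A B |A||B|≤m few-agreements with
  small-total⇒zero-entry total (s≤s (ℕₚ.*-cancelˡ-≤ m (ℕₚ.≤-trans total-bound size-bound)))
  where
  agreements-with : Fin _ → Vec ℕ (suc l)
  agreements-with x = subsetSum (λ y → agreement (w x) (w y)) B
  total : Vec ℕ (suc l)
  total = subsetSum agreements-with A
  total-bound : m * sum total ≤ ∣ A ∣ * (∣ B ∣ * l)
  total-bound = subsetSum-total m _ agreements-with A λ x x∈A →
    subsetSum-total m l _ B λ y y∈B → few-agreements x y x∈A y∈B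
  size-bound : ∣ A ∣ * (∣ B ∣ * l) ≤ m * l
  size-bound = subst (_≤ m * l) (ℕₚ.*-assoc ∣ A ∣ ∣ B ∣ l) (ℕₚ.*-monoˡ-≤ l |A||B|≤m)
... | i , total[i]≡0 = i , λ x y x∈A y∈B →
  agreement-zero⇒differ (w x) (w y) i
    (subsetSum-zero _ B (subsetSum-zero _ A total[i]≡0 x∈A) y∈B)

-- The proposition: with m = ab, distinct codewords agree in fewer than ℓ/m coordinates,
-- and disjointness of A and B with injectivity of lab makes every pair of A × B distinct.
proposition3p5 : (N a b ℓ q : ℕ) .{{_ : NonZero a}} .{{_ : NonZero b}} .{{_ : NonZero ℓ}} →
    b ≤ a →
    (δ : ℚ) → 0ℚ ≤ℚ δ → δ ≤ℚ 1ℚ →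
    1ℚ - _/_ (+ 1) (a * b) {{m*n≢0 a b}} <ℚ δ →
    (C : Word q ℓ → Set) → IsCode N q ℓ δ C →
    (lab : Fin N → Word q ℓ) → Injective _≡_ _≡_ lab → (∀ x → C (lab x)) →
    HitAndMiss N a b ℓ q (λ i x → lookup (lab x) i)
proposition3p5 N zero b ℓ q {{a≢0}} = ⊥-elim-irr (NonZero.nonZero a≢0)
proposition3p5 N (suc a) zero ℓ q {{_}} {{b≢0}} = ⊥-elim-irr (NonZero.nonZero b≢0)
proposition3p5 N (suc a) (suc b) zero q {{_}} {{_}} {{ℓ≢0}} = ⊥-elim-irr (NonZero.nonZero ℓ≢0)
proposition3p5 N (suc a) (suc b) (suc l) q _ δ _ _ δ-large C (_ , distance) lab lab-injective
               lab∈C A B disjoint |A|≤a |B|≤b =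
  separating-coordinate (suc a * suc b) lab A B (ℕₚ.*-mono-≤ |A|≤a |B|≤b) few-agreements
  where
  distinct : ∀ x y → x ∈ A → y ∈ B → lab x ≢ lab y
  distinct x y x∈A y∈B labx≡laby =
    disjoint x x∈A (subst (_∈ B) (sym (lab-injective labx≡laby)) y∈B)
  -- suc a * suc b reduces to suc m-1.
  m-1 : ℕ
  m-1 = b + a * suc b
  few-agreements : ∀ x y → x ∈ A → y ∈ B → suc a * suc b * sum (agreement (lab x) (lab y)) ≤ l
  few-agreements x y x∈A y∈B = ℕₚ.≤-pred (far-words-agree-rarely m-1 (lab x) (lab y)
    (ℚₚ.<-≤-trans δ-large (distance _ _ (lab∈C x) (lab∈C y) (distinct x y x∈A y∈B))))
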